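{- For any group $\mathbf{G}=(G,\cdot)$ and $a,b\in G$, the set $\Lambda_{\mathbf{G}}(a,b)=\{(r,s)\in\mathbb{Z}\times\mathbb{Z}: ba^rb^{ -1}=ab^{ -s}a^{ -1}\}$ is a subgroup of $\mathbb{Z}\times\mathbb{Z}$. -}

module Defs where

open import Level using (Level; _⊔_)
open import Algebra.Bundles using (Group)
open import Data.Nat using (ℕ; zero; suc)
open import Data.Integer using (ℤ; +_; -[1+_]; _+_; -_; 0ℤ)
open import Data.Product using (_×_; _,_)

module GroupPow {c ℓ : Level} (G : Group c ℓ) where
  open Group G

  _^ℕ_ : Carrier → ℕ → Carrier
  x ^ℕ zero  = ε
  x ^ℕ suc n = x ∙ (x ^ℕ n)

  _^_ : Carrier → ℤ → Carrier
  x ^ (+ n)      = x ^ℕ n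
  x ^ (-[1+ n ]) = (x ^ℕ suc n) ⁻¹

  Λ : Carrier → Carrier → ℤ × ℤ → Set ℓ
  Λ a b (r , s) = ((b ∙ (a ^ r)) ∙ (b ⁻¹)) ≈ ((a ∙ (b ^ (- s))) ∙ (a ⁻¹))

record IsSubgroupℤ² {p : Level} (P : ℤ × ℤ → Set p) : Set p where
  field
    has-zero : P (0ℤ , 0ℤ)
    +-closed : ∀ {r s r′ s′} → P (r , s) → P (r′ , s′) → P (r + r′ , s + s′)
    neg-closed : ∀ {r s} → P (r , s) → P (- r , - s)

-- Λ(a, b) = {(r, s) : φ r = ψ s} for the homomorphisms φ r = b a^r b⁻¹ and
-- ψ s = a b^{-s} a⁻¹ from (ℤ, +) to G (composites of r ↦ a^r, negation and
-- conjugation), and the pullback of two homomorphisms into G is a subgroup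
-- of ℤ × ℤ.
module Submission where

open import Defs
open import Level using (Level)
open import Algebra.Bundles using (Group)
open import Data.Nat using (zero; suc)
open import Data.Integer using (ℤ; +_; -[1+_]; _+_; -_; 0ℤ; pred) renaming (suc to sucℤ)
open import Data.Integer.Properties using (+-identityˡ; suc-+; pred-+; pred-suc; +-inverseʳ; neg-distrib-+)
open import Data.Product using (_,_)
open import Relation.Binary.PropositionalEquality as ≡ using (_≡_)
import Algebra.Morphism.Definitions as MorphismDefinitions
import Algebra.Properties.Group as GroupProperties
import Relation.Binary.Reasoning.Setoid as SetoidReasoning

module _ {c ℓ : Level} (G : Group c ℓ) where
  open Group G
  open GroupPow G
  open GroupProperties G
  open SetoidReasoning setoid
  open MorphismDefinitions ℤ Carrier _≈_ using (Homomorphic₂)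

  module _ {f : ℤ → Carrier} (f-homo : Homomorphic₂ f _+_ _∙_) where

    homo-ε : f 0ℤ ≈ ε
    homo-ε = identityʳ-unique (f 0ℤ) (f 0ℤ) (sym (f-homo 0ℤ 0ℤ))

    homo-⁻¹ : ∀ n → f (- n) ≈ f n ⁻¹
    homo-⁻¹ n = inverseʳ-unique (f n) (f (- n)) (begin
      f n ∙ f (- n) ≈⟨ f-homo n (- n) ⟨
      f (n + - n)   ≡⟨ ≡.cong f (+-inverseʳ n) ⟩
      f 0ℤ          ≈⟨ homo-ε ⟩
      ε             ∎)

    homo∘neg : Homomorphic₂ (λ n → f (- n)) _+_ _∙_
    homo∘neg m n = begin
      f (- (m + n))   ≡⟨ ≡.cong f (neg-distrib-+ m n) ⟩
      f (- m + - n)   ≈⟨ f-homo (- m) (- n) ⟩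
      f (- m) ∙ f (- n) ∎

  pullback-isSubgroupℤ² : ∀ {f g : ℤ → Carrier} →
                           Homomorphic₂ f _+_ _∙_ → Homomorphic₂ g _+_ _∙_ →
                           IsSubgroupℤ² (λ { (r , s) → f r ≈ g s })
  pullback-isSubgroupℤ² {f} {g} f-homo g-homo = record
    { has-zero   = trans (homo-ε f-homo) (sym (homo-ε g-homo))
    ; +-closed   = λ {r} {s} {r′} {s′} fr≈gs fr′≈gs′ → begin
        f (r + r′)   ≈⟨ f-homo r r′ ⟩
        f r ∙ f r′   ≈⟨ ∙-cong fr≈gs fr′≈gs′ ⟩
        g s ∙ g s′   ≈⟨ g-homo s s′ ⟨
        g (s + s′)   ∎
    ; neg-closed = λ {r} {s} fr≈gs → begin
        f (- r)      ≈⟨ homo-⁻¹ f-homo r ⟩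
        f r ⁻¹       ≈⟨ ⁻¹-cong fr≈gs ⟩
        g s ⁻¹       ≈⟨ homo-⁻¹ g-homo s ⟨
        g (- s)      ∎
    }

  x∙x^n≈x^n∙x : ∀ x n → x ∙ x ^ℕ n ≈ x ^ℕ n ∙ x
  x∙x^n≈x^n∙x x zero    = trans (identityʳ x) (sym (identityˡ x))
  x∙x^n≈x^n∙x x (suc n) = trans (∙-congˡ (x∙x^n≈x^n∙x x n)) (sym (assoc _ _ _))

  ^-pred : ∀ x n → x ^ pred n ≈ x ⁻¹ ∙ x ^ n
  ^-pred x (+ zero)  = trans (⁻¹-cong (identityʳ x)) (sym (identityʳ _))
  ^-pred x (+ suc n) = begin
    x ^ℕ n                ≈⟨ identityˡ _ ⟨
    ε ∙ x ^ℕ n            ≈⟨ ∙-congʳ (inverseˡ x) ⟨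
    (x ⁻¹ ∙ x) ∙ x ^ℕ n   ≈⟨ assoc _ _ _ ⟩
    x ⁻¹ ∙ x ^ℕ suc n     ∎
  ^-pred x -[1+ n ]  = begin
    (x ∙ x ^ℕ suc n) ⁻¹   ≈⟨ ⁻¹-cong (x∙x^n≈x^n∙x x (suc n)) ⟩
    (x ^ℕ suc n ∙ x) ⁻¹   ≈⟨ ⁻¹-anti-homo-∙ _ x ⟩
    x ⁻¹ ∙ x ^ -[1+ n ]   ∎

  ^-suc : ∀ x n → x ^ sucℤ n ≈ x ∙ x ^ n
  ^-suc x n = begin
    x ^ sucℤ n                    ≈⟨ identityˡ _ ⟨
    ε ∙ x ^ sucℤ n                ≈⟨ ∙-congʳ (inverseʳ x) ⟨
    (x ∙ x ⁻¹) ∙ x ^ sucℤ n       ≈⟨ assoc _ _ _ ⟩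
    x ∙ (x ⁻¹ ∙ x ^ sucℤ n)       ≈⟨ ∙-congˡ (^-pred x (sucℤ n)) ⟨
    x ∙ x ^ pred (sucℤ n)         ≡⟨ ≡.cong (λ k → x ∙ x ^ k) (pred-suc n) ⟩
    x ∙ x ^ n                     ∎

  ^-homo-+-step : ∀ x y (σ : ℤ → ℤ) → (∀ n → x ^ σ n ≈ y ∙ x ^ n) →
                  ∀ m → (∀ n → σ m + n ≡ σ (m + n)) →
                  (∀ n → x ^ (m + n) ≈ x ^ m ∙ x ^ n) →
                  ∀ n → x ^ (σ m + n) ≈ x ^ σ m ∙ x ^ n
  ^-homo-+-step x y σ ^-σ m σ-+ ^-+ n = begin
    x ^ (σ m + n)        ≡⟨ ≡.cong (x ^_) (σ-+ n) ⟩
    x ^ σ (m + n)        ≈⟨ ^-σ (m + n) ⟩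
    y ∙ x ^ (m + n)      ≈⟨ ∙-congˡ (^-+ n) ⟩
    y ∙ (x ^ m ∙ x ^ n)  ≈⟨ assoc _ _ _ ⟨
    (y ∙ x ^ m) ∙ x ^ n  ≈⟨ ∙-congʳ (^-σ m) ⟨
    x ^ σ m ∙ x ^ n      ∎

  ^-homo-+ : ∀ x → Homomorphic₂ (x ^_) _+_ _∙_
  ^-homo-+ x (+ zero)      n = begin
    x ^ (0ℤ + n)    ≡⟨ ≡.cong (x ^_) (+-identityˡ n) ⟩
    x ^ n           ≈⟨ identityˡ _ ⟨
    ε ∙ x ^ n       ∎
  ^-homo-+ x (+ suc m)     n =
    ^-homo-+-step x x sucℤ (^-suc x) (+ m) (suc-+ m) (^-homo-+ x (+ m)) n
  ^-homo-+ x -[1+ zero ]   n = trans (^-pred x n) (∙-congʳ (⁻¹-cong (sym (identityʳ x))))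
  ^-homo-+ x -[1+ suc m ]  n =
    ^-homo-+-step x (x ⁻¹) pred (^-pred x) -[1+ m ] (pred-+ -[1+ m ]) (^-homo-+ x -[1+ m ]) n

  conj : Carrier → Carrier → Carrier
  conj g x = (g ∙ x) ∙ g ⁻¹

  conj-homo-∙ : ∀ g x y → conj g (x ∙ y) ≈ conj g x ∙ conj g y
  conj-homo-∙ g x y = begin
    (g ∙ (x ∙ y)) ∙ g ⁻¹                    ≈⟨ ∙-congʳ (assoc g x y) ⟨
    ((g ∙ x) ∙ y) ∙ g ⁻¹                    ≈⟨ assoc _ y _ ⟩
    (g ∙ x) ∙ (y ∙ g ⁻¹)                    ≈⟨ ∙-congˡ (identityˡ _) ⟨
    (g ∙ x) ∙ (ε ∙ (y ∙ g ⁻¹))              ≈⟨ ∙-congˡ (∙-congʳ (inverseˡ g)) ⟨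
    (g ∙ x) ∙ ((g ⁻¹ ∙ g) ∙ (y ∙ g ⁻¹))     ≈⟨ ∙-congˡ (assoc _ g _) ⟩
    (g ∙ x) ∙ (g ⁻¹ ∙ (g ∙ (y ∙ g ⁻¹)))     ≈⟨ ∙-congˡ (∙-congˡ (assoc g y _)) ⟨
    (g ∙ x) ∙ (g ⁻¹ ∙ ((g ∙ y) ∙ g ⁻¹))     ≈⟨ assoc _ _ _ ⟨
    ((g ∙ x) ∙ g ⁻¹) ∙ ((g ∙ y) ∙ g ⁻¹)     ∎

  conj∘homo : ∀ g {f : ℤ → Carrier} → Homomorphic₂ f _+_ _∙_ →
              Homomorphic₂ (λ n → conj g (f n)) _+_ _∙_
  conj∘homo g {f} f-homo m n = begin
    conj g (f (m + n))          ≈⟨ ∙-congʳ (∙-congˡ (f-homo m n)) ⟩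
    conj g (f m ∙ f n)          ≈⟨ conj-homo-∙ g (f m) (f n) ⟩
    conj g (f m) ∙ conj g (f n) ∎

lemma5p4 : {c ℓ : Level} (G : Group c ℓ) → (a b : Group.Carrier G) → IsSubgroupℤ² (GroupPow.Λ G a b)
lemma5p4 G a b = pullback-isSubgroupℤ² G
  (conj∘homo G b (^-homo-+ G a))
  (homo∘neg G (conj∘homo G a (^-homo-+ G b)))
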